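{- Let $F$ be a 2-CNF formula that contains no semicomplete sub-multiset of clauses, and let $k\ge 0$ be an integer. If $F$ has more than $3k-2$ significant variables, then $\mathrm{sat}(F)\ge (3|F|+k)/4$.
   Context: A literal is a variable $x$ or its negation $\overline{x}$. A clause is a finite set of literals with no complementary pair; a 2-CNF formula is a finite multiset of clauses each with exactly 2 literals; $|F|$ is the number of clauses counted with multiplicity. Clause $\{p,q\}$ is written $pq$. A truth assignment with values in $\{ -1,1\}$ satisfies a clause if some positive literal $x$ in it has value $1$ or some negative literal $\overline{x}$ in it has $x$ of value $-1$; $\mathrm{sat}(F)$ is the maximum over truth assignments of the variables of $F$ of the number of satisfied clauses. Two distinct clauses $Y,Z$ have a conflict if some literal $p\in Y$ has $\overline{p}\in Z$; a 2-CNF formula is semicomplete if it has exactly $4$ clauses and every pair of distinct clauses has a conflict. A variable $x$ of $F$ is insignificant if for each literal $y$ the number of occurrences of the clause $xy$ in $F$ equals the number of occurrences of the clause $\overline{x}y$ in $F$; otherwise $x$ is significant. -}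

module Defs where

open import Data.Nat using (ℕ; _+_; _*_; _<_; _≤_; _≡ᵇ_)
open import Data.Bool using (Bool; true; false; not; _∨_; _∧_; if_then_else_)
open import Data.List using (List; []; _∷_; length; lookup)
open import Data.List.Relation.Unary.All using (All)
open import Data.List.Relation.Unary.Unique.Propositional using (Unique)
open import Data.Fin using (Fin)
open import Data.Product using (Σ; ∃; _×_; _,_)
open import Data.Sum using (_⊎_)
open import Relation.Binary.PropositionalEquality using (_≡_; _≢_)
open import Function.Definitions using (Injective)

data Lit : Set where
  pos : ℕ → Lit
  neg : ℕ → Lit

var : Lit → ℕ
var (pos x) = x
var (neg x) = x

compl : Lit → Lit
compl (pos x) = neg x
compl (neg x) = pos x

_==L_ : Lit → Lit → Bool
pos x ==L pos y = x ≡ᵇ y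
neg x ==L neg y = x ≡ᵇ y
_ ==L _ = false

-- A 2-literal clause {l₁, l₂}; the two literals are on distinct variables
-- (distinct and non-complementary).
record Clause : Set where
  constructor mkClause
  field
    l₁ l₂ : Lit
    distinct : var l₁ ≢ var l₂
open Clause public

-- A 2-CNF formula: a finite multiset of clauses, represented as a list.
Formula : Set
Formula = List Clause

size : Formula → ℕ
size = length

_∈C_ : Lit → Clause → Set
p ∈C C = p ≡ l₁ C ⊎ p ≡ l₂ C

isClause : Lit → Lit → Clause → Bool
isClause p q C = ((l₁ C ==L p) ∧ (l₂ C ==L q)) ∨ ((l₁ C ==L q) ∧ (l₂ C ==L p))

occ : Formula → Lit → Lit → ℕ
occ [] p q = 0
occ (C ∷ F) p q = (if isClause p q C then 1 else 0) + occ F p q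

-- truth assignments (true ↔ 1, false ↔ -1)
Assignment : Set
Assignment = ℕ → Bool

litVal : Assignment → Lit → Bool
litVal α (pos x) = α x
litVal α (neg x) = not (α x)

satisfies : Assignment → Clause → Bool
satisfies α C = litVal α (l₁ C) ∨ litVal α (l₂ C)

numSat : Assignment → Formula → ℕ
numSat α [] = 0
numSat α (C ∷ F) = (if satisfies α C then 1 else 0) + numSat α F

Conflict : Clause → Clause → Set
Conflict Y Z = ∃ λ p → p ∈C Y × compl p ∈C Z

-- F contains a semicomplete sub-multiset: four clauses at four distinct
-- positions of F, every two of which have a conflict.
HasSemicompleteSub : Formula → Set
HasSemicompleteSub F =
  Σ (Fin 4 → Fin (length F)) λ f →
    Injective _≡_ _≡_ f ×
    (∀ a b → a ≢ b → Conflict (lookup F (f a)) (lookup F (f b)))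

Significant : Formula → ℕ → Set
Significant F x = ∃ λ (y : Lit) → occ F (pos x) y ≢ occ F (neg x) y

AtLeastSignificant : Formula → ℕ → Set
AtLeastSignificant F m =
  ∃ λ (xs : List ℕ) → Unique xs × All (Significant F) xs × m ≤ length xs

-- sat(F) ≥ r/4, i.e. some assignment satisfies at least r/4 clauses
-- (stated without division: 4 · #satisfied ≥ r)
FourSatAtLeast : Formula → ℕ → Set
FourSatAtLeast F r = ∃ λ (α : Assignment) → r ≤ 4 * numSat α F

module Submission where

-- With truth values read as ±1, four times the number of clauses satisfied
-- by α is  3|F| + X_F(α)  for a multilinear quadratic polynomial X_F, the
-- Fourier expansion of F (numSat-eval).  It therefore suffices to make
-- X_F(α) ≥ k, which follows from two facts:
--  (1) lowerBound: if m distinct variables occur in a multilinear quadratic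
--      polynomial (have a nonzero coefficient), some assignment gives it a
--      value ≥ m/3.  Variables are fixed one at a time; each fair reduction
--      (reduce, built from linearStep) gains one unit of value per at most
--      three variables that stop occurring.
--  (2) significant-occurs: without semicomplete subformula, every
--      significant variable x occurs in X_F.  The coefficients of x count
--      the partners of x and x̄ in clauses of F; if they all vanished, a
--      multiset argument (complementary-pair) would exhibit four pairwise
--      conflicting clauses  p y, p ȳ, p̄ w, p̄ w̄.

open import Defs
open import Data.Nat using (ℕ; _+_; _*_; _∸_)
open import Relation.Nullary using (¬_)

open import Data.Bool using (Bool; true; false; _∧_; _∨_; if_then_else_; T)
open import Data.Bool.Properties using (T-≡; ∧-zeroʳ; ∧-comm)
open import Data.Empty using (⊥; ⊥-elim)
open import Data.Integer as ℤ using (ℤ; +_; -[1+_]; 0ℤ; 1ℤ; -1ℤ)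
  renaming (_+_ to _+ᶻ_; _*_ to _*ᶻ_; _≤_ to _≤ᶻ_)
import Data.Integer.Properties as ℤP
open import Data.Integer.Tactic.RingSolver using (solve-∀)
open import Data.Nat.Tactic.RingSolver using () renaming (solve-∀ to solveℕ)
open import Data.Fin as Fin using (Fin)
open import Data.Fin.Patterns using (0F; 1F; 2F; 3F)
open import Data.List using (List; []; _∷_; _++_; length; concatMap; filter; lookup)
import Data.List.Relation.Unary.All as All
import Data.List.Relation.Unary.All.Properties as All
import Data.List.Relation.Unary.Unique.Propositional.Properties as Unique
open import Data.List.Relation.Unary.Unique.Propositional using (Unique; []; _∷_)
open import Data.List.Relation.Unary.All using (All; []; _∷_)
open import Data.List.Relation.Unary.All.Properties using (++⁺)
open import Data.List.Relation.Unary.Any using (Any; here; there; any?)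
open import Data.List.Membership.Propositional using (_∈_; lose; find)
open import Data.List.Membership.Propositional.Properties using (∈-++⁻)
open import Data.List.Properties using (length-++)
open import Data.Nat as ℕ using (zero; suc; _≡ᵇ_; _≤_; _<_; z≤n; s≤s)
import Data.Nat.Properties as ℕP
open import Data.Nat.Properties using (≡ᵇ⇒≡; ≡⇒≡ᵇ)
open import Data.Product using (Σ; ∃; _×_; _,_; proj₁; proj₂)
open import Data.Sum using (_⊎_; inj₁; inj₂)
open import Data.Unit using (⊤; tt)
open import Function.Bundles using (Equivalence)
open import Relation.Binary.Definitions using (tri<; tri≈; tri>)
open import Relation.Binary.PropositionalEquality
open import Relation.Nullary using (Dec; yes; no; ¬?)
open import Relation.Nullary.Decidable using (_×-dec_)
open import Relation.Unary using (Decidable)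
open import Relation.Unary.Properties using (∁?)
open import Relation.Nullary.Reflects using (Reflects; ofʸ; ofⁿ; fromEquivalence)

≡ᵇ-reflects : ∀ m n → Reflects (m ≡ n) (m ≡ᵇ n)
≡ᵇ-reflects m n = fromEquivalence (≡ᵇ⇒≡ m n) (≡⇒≡ᵇ m n)

≡ᵇ-refl : ∀ n → (n ≡ᵇ n) ≡ true
≡ᵇ-refl n = Equivalence.to T-≡ (≡⇒≡ᵇ n n refl)

≢⇒≡ᵇ-false : ∀ {m n} → m ≢ n → (m ≡ᵇ n) ≡ false
≢⇒≡ᵇ-false {m} {n} m≢n with m ≡ᵇ n | ≡ᵇ-reflects m n
... | true  | ofʸ m≡n = ⊥-elim (m≢n m≡n)
... | false | _       = refl

-- Pseudo-Boolean polynomials in ±1 variables without constant term: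
-- a list of monomials  c·x  and  c·x·y.
data Mono : Set where
  lin  : (x : ℕ) (c : ℤ) → Mono
  quad : (x y : ℕ) (c : ℤ) → Mono

Poly : Set
Poly = List Mono

sg : Bool → ℤ
sg true  = 1ℤ
sg false = -1ℤ

[_]·_ : Bool → ℤ → ℤ
[ b ]· c = if b then c else 0ℤ

total : (Mono → ℤ) → Poly → ℤ
total g []      = 0ℤ
total g (t ∷ f) = g t +ᶻ total g f

evalMono : Assignment → Mono → ℤ
evalMono α (lin x c)    = c *ᶻ sg (α x)
evalMono α (quad x y c) = c *ᶻ (sg (α x) *ᶻ sg (α y))

eval : Assignment → Poly → ℤ
eval α = total (evalMono α)

linCoefMono : ℕ → Mono → ℤ
linCoefMono x (lin y c)      = [ y ≡ᵇ x ]· c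
linCoefMono x (quad _ _ _)   = 0ℤ

quadCoefMono : ℕ → ℕ → Mono → ℤ
quadCoefMono x y (lin _ _)    = 0ℤ
quadCoefMono x y (quad u w c) = [ (u ≡ᵇ x) ∧ (w ≡ᵇ y) ]· c +ᶻ [ (w ≡ᵇ x) ∧ (u ≡ᵇ y) ]· c

linCoef : ℕ → Poly → ℤ
linCoef x = total (linCoefMono x)

quadCoef : ℕ → ℕ → Poly → ℤ
quadCoef x y = total (quadCoefMono x y)

MultilinearMono : Mono → Set
MultilinearMono (lin _ _)    = ⊤
MultilinearMono (quad x y _) = x ≢ y

Multilinear : Poly → Set
Multilinear = All MultilinearMono

AbsentMono : ℕ → Mono → Set
AbsentMono z (lin y _)    = y ≢ z
AbsentMono z (quad u w _) = u ≢ z × w ≢ z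

Absent : ℕ → Poly → Set
Absent z = All (AbsentMono z)

-- Termination measure: total degree.
degree : Mono → ℕ
degree (lin _ _)    = 1
degree (quad _ _ _) = 2

weight : Poly → ℕ
weight []      = 0
weight (t ∷ f) = degree t + weight f

vars : Poly → List ℕ
vars []                = []
vars (lin y _ ∷ f)     = y ∷ vars f
vars (quad u w _ ∷ f)  = u ∷ w ∷ vars f

interchange : ∀ a b c d → (a +ᶻ b) +ᶻ (c +ᶻ d) ≡ (a +ᶻ c) +ᶻ (b +ᶻ d)
interchange = solve-∀

total-++ : ∀ g f h → total g (f ++ h) ≡ total g f +ᶻ total g h
total-++ g []      h = sym (ℤP.+-identityˡ _)
total-++ g (t ∷ f) h rewrite total-++ g f h = sym (ℤP.+-assoc (g t) _ _)

total-+ : ∀ g h f → total (λ t → g t +ᶻ h t) f ≡ total g f +ᶻ total h f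
total-+ g h []      = refl
total-+ g h (t ∷ f) rewrite total-+ g h f = interchange (g t) (h t) _ _

total-scale : ∀ s g f → total (λ t → s *ᶻ g t) f ≡ s *ᶻ total g f
total-scale s g []      = sym (ℤP.*-zeroʳ s)
total-scale s g (t ∷ f) rewrite total-scale s g f = sym (ℤP.*-distribˡ-+ s (g t) _)

total-cong : ∀ {g h} f → All (λ t → g t ≡ h t) f → total g f ≡ total h f
total-cong []      []         = refl
total-cong (t ∷ f) (e ∷ es) = cong₂ _+ᶻ_ e (total-cong f es)

total-cong′ : ∀ {g h} → (∀ t → g t ≡ h t) → ∀ f → total g f ≡ total h f
total-cong′ e []      = refl
total-cong′ e (t ∷ f) = cong₂ _+ᶻ_ (e t) (total-cong′ e f)

total-concatMap : ∀ g (m : Mono → Poly) f →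
                  total g (concatMap m f) ≡ total (λ t → total g (m t)) f
total-concatMap g m []      = refl
total-concatMap g m (t ∷ f) rewrite total-++ g (m t) (concatMap m f) | total-concatMap g m f = refl

fixConst : ℕ → Bool → Mono → ℤ
fixConst z a (lin y c)    = [ y ≡ᵇ z ]· (sg a *ᶻ c)
fixConst z a (quad _ _ _) = 0ℤ

fixMono : ℕ → Bool → Mono → Poly
fixMono z a (lin y c)    = if y ≡ᵇ z then [] else lin y c ∷ []
fixMono z a (quad u w c) =
  if u ≡ᵇ z then lin w (sg a *ᶻ c) ∷ []
  else if w ≡ᵇ z then lin u (sg a *ᶻ c) ∷ []
  else quad u w c ∷ []

fix : ℕ → Bool → Poly → Poly
fix z a = concatMap (fixMono z a)

pad : ∀ x → x ≡ 0ℤ +ᶻ (x +ᶻ 0ℤ)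
pad = solve-∀

fixMono-eval : ∀ {α z a} t → α z ≡ a → MultilinearMono t →
               evalMono α t ≡ fixConst z a t +ᶻ eval α (fixMono z a t)
fixMono-eval {α} {z} {a} (lin y c) αz≡a _ with y ≡ᵇ z | ≡ᵇ-reflects y z
... | true  | ofʸ refl rewrite αz≡a = absorb c (sg a)
  where absorb : ∀ c s → c *ᶻ s ≡ s *ᶻ c +ᶻ 0ℤ
        absorb = solve-∀
... | false | _ = pad (c *ᶻ sg (α y))
fixMono-eval {α} {z} {a} (quad u w c) αz≡a u≢w with u ≡ᵇ z | ≡ᵇ-reflects u z
... | true  | ofʸ refl rewrite αz≡a = fixed-first c (sg a) (sg (α w))
  where fixed-first : ∀ c s t → c *ᶻ (s *ᶻ t) ≡ 0ℤ +ᶻ ((s *ᶻ c) *ᶻ t +ᶻ 0ℤ)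
        fixed-first = solve-∀
... | false | _ with w ≡ᵇ z | ≡ᵇ-reflects w z
...   | true  | ofʸ refl rewrite αz≡a = fixed-second c (sg (α u)) (sg a)
  where fixed-second : ∀ c s t → c *ᶻ (s *ᶻ t) ≡ 0ℤ +ᶻ ((t *ᶻ c) *ᶻ s +ᶻ 0ℤ)
        fixed-second = solve-∀
...   | false | _ = pad (c *ᶻ (sg (α u) *ᶻ sg (α w)))

fixConst-lin : ∀ z a t → fixConst z a t ≡ sg a *ᶻ linCoefMono z t
fixConst-lin z a (lin y c) with y ≡ᵇ z
... | true  = refl
... | false = sym (ℤP.*-zeroʳ (sg a))
fixConst-lin z a (quad _ _ _) = sym (ℤP.*-zeroʳ (sg a))

fix-eval : ∀ {α z a} f → α z ≡ a → Multilinear f →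
           eval α f ≡ sg a *ᶻ linCoef z f +ᶻ eval α (fix z a f)
fix-eval {α} {z} {a} f αz≡a ml = begin
  eval α f
    ≡⟨ total-cong f (All.map (λ {t} → fixMono-eval t αz≡a) ml) ⟩
  total (λ t → fixConst z a t +ᶻ eval α (fixMono z a t)) f
    ≡⟨ total-+ (fixConst z a) (λ t → eval α (fixMono z a t)) f ⟩
  total (fixConst z a) f +ᶻ total (λ t → eval α (fixMono z a t)) f
    ≡⟨ cong₂ _+ᶻ_ (trans (total-cong′ (fixConst-lin z a) f) (total-scale (sg a) (linCoefMono z) f))
                  (sym (total-concatMap (evalMono α) (fixMono z a) f)) ⟩
  sg a *ᶻ linCoef z f +ᶻ eval α (fix z a f)
    ∎
  where open ≡-Reasoning

vanish : ∀ c s → c ≡ c +ᶻ s *ᶻ 0ℤ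
vanish = solve-∀

[·]-scale : ∀ b s c → [ b ]· (s *ᶻ c) ≡ s *ᶻ [ b ]· c
[·]-scale true  s c = refl
[·]-scale false s c = sym (ℤP.*-zeroʳ s)

fixMono-linCoef : ∀ {y z} a → y ≢ z → ∀ t →
                  linCoef y (fixMono z a t) ≡ linCoefMono y t +ᶻ sg a *ᶻ quadCoefMono z y t
fixMono-linCoef {y} {z} a y≢z (lin v c) with v ≡ᵇ z | ≡ᵇ-reflects v z
... | true  | ofʸ refl rewrite ≢⇒≡ᵇ-false (λ e → y≢z (sym e)) = vanish 0ℤ (sg a)
... | false | _ = cong (linCoefMono y (lin v c) +ᶻ_) (sym (ℤP.*-zeroʳ (sg a)))
fixMono-linCoef {y} {z} a y≢z (quad u w c) with u ≡ᵇ z | ≡ᵇ-reflects u z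
... | true  | ofʸ refl
  rewrite ≢⇒≡ᵇ-false (λ e → y≢z (sym e)) | ∧-zeroʳ (w ≡ᵇ z) | [·]-scale (w ≡ᵇ y) (sg a) c
  = shape (sg a) _
  where shape : ∀ s x → s *ᶻ x +ᶻ 0ℤ ≡ 0ℤ +ᶻ s *ᶻ (x +ᶻ 0ℤ)
        shape = solve-∀
... | false | _ with w ≡ᵇ z | ≡ᵇ-reflects w z
...   | true  | ofʸ refl
  rewrite [·]-scale (u ≡ᵇ y) (sg a) c = shape (sg a) _
  where shape : ∀ s x → s *ᶻ x +ᶻ 0ℤ ≡ 0ℤ +ᶻ s *ᶻ (0ℤ +ᶻ x)
        shape = solve-∀
...   | false | _ = vanish 0ℤ (sg a)

fix-linCoef : ∀ {y z} a f → y ≢ z →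
              linCoef y (fix z a f) ≡ linCoef y f +ᶻ sg a *ᶻ quadCoef z y f
fix-linCoef {y} {z} a f y≢z = begin
  linCoef y (fix z a f)
    ≡⟨ total-concatMap (linCoefMono y) (fixMono z a) f ⟩
  total (λ t → linCoef y (fixMono z a t)) f
    ≡⟨ total-cong′ (fixMono-linCoef a y≢z) f ⟩
  total (λ t → linCoefMono y t +ᶻ sg a *ᶻ quadCoefMono z y t) f
    ≡⟨ total-+ (linCoefMono y) (λ t → sg a *ᶻ quadCoefMono z y t) f ⟩
  linCoef y f +ᶻ total (λ t → sg a *ᶻ quadCoefMono z y t) f
    ≡⟨ cong (linCoef y f +ᶻ_) (total-scale (sg a) (quadCoefMono z y) f) ⟩
  linCoef y f +ᶻ sg a *ᶻ quadCoef z y f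
    ∎
  where open ≡-Reasoning

fixMono-quadCoef : ∀ {x y z} a → x ≢ z → y ≢ z → ∀ t →
                   quadCoef x y (fixMono z a t) ≡ quadCoefMono x y t
fixMono-quadCoef {x} {y} {z} a x≢z y≢z (lin v c) with v ≡ᵇ z
... | true  = refl
... | false = refl
fixMono-quadCoef {x} {y} {z} a x≢z y≢z (quad u w c) with u ≡ᵇ z | ≡ᵇ-reflects u z
... | true  | ofʸ refl
  rewrite ≢⇒≡ᵇ-false (λ e → x≢z (sym e)) | ≢⇒≡ᵇ-false (λ e → y≢z (sym e))
        | ∧-zeroʳ (w ≡ᵇ x) = refl
... | false | _ with w ≡ᵇ z | ≡ᵇ-reflects w z
...   | true  | ofʸ refl
  rewrite ≢⇒≡ᵇ-false (λ e → x≢z (sym e)) | ≢⇒≡ᵇ-false (λ e → y≢z (sym e))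
        | ∧-zeroʳ (u ≡ᵇ x) = refl
...   | false | _ = ℤP.+-identityʳ _

fix-quadCoef : ∀ {x y z} a f → x ≢ z → y ≢ z → quadCoef x y (fix z a f) ≡ quadCoef x y f
fix-quadCoef {x} {y} {z} a f x≢z y≢z =
  trans (total-concatMap (quadCoefMono x y) (fixMono z a) f)
        (total-cong′ (fixMono-quadCoef a x≢z y≢z) f)

All-concatMap : ∀ {P Q : Mono → Set} (m : Mono → Poly) →
                (∀ {t} → P t → All Q (m t)) → ∀ {f} → All P f → All Q (concatMap m f)
All-concatMap m h []       = []
All-concatMap m h (p ∷ ps) = ++⁺ (h p) (All-concatMap m h ps)

fixMono-multilinear : ∀ z a {t} → MultilinearMono t → Multilinear (fixMono z a t)
fixMono-multilinear z a {lin v c} _ with v ≡ᵇ z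
... | true  = []
... | false = tt ∷ []
fixMono-multilinear z a {quad u w c} u≢w with u ≡ᵇ z
... | true  = tt ∷ []
... | false with w ≡ᵇ z
...   | true  = tt ∷ []
...   | false = u≢w ∷ []

fix-multilinear : ∀ z a {f} → Multilinear f → Multilinear (fix z a f)
fix-multilinear z a = All-concatMap (fixMono z a) (fixMono-multilinear z a)

fixMono-absent : ∀ z a {t} → MultilinearMono t → Absent z (fixMono z a t)
fixMono-absent z a {lin v c} _ with v ≡ᵇ z | ≡ᵇ-reflects v z
... | true  | _        = []
... | false | ofⁿ v≢z = v≢z ∷ []
fixMono-absent z a {quad u w c} u≢w with u ≡ᵇ z | ≡ᵇ-reflects u z
... | true  | ofʸ refl = (λ w≡u → u≢w (sym w≡u)) ∷ []
... | false | ofⁿ u≢z with w ≡ᵇ z | ≡ᵇ-reflects w z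
...   | true  | _        = u≢z ∷ []
...   | false | ofⁿ w≢z = (u≢z , w≢z) ∷ []

fix-absent : ∀ z a {f} → Multilinear f → Absent z (fix z a f)
fix-absent z a = All-concatMap (fixMono z a) (fixMono-absent z a)

weight-++ : ∀ f h → weight (f ++ h) ≡ weight f + weight h
weight-++ []      h = refl
weight-++ (t ∷ f) h rewrite weight-++ f h = sym (ℕP.+-assoc (degree t) _ _)

fixMono-weight : ∀ z a t → weight (fixMono z a t) ≤ degree t
fixMono-weight z a (lin v c) with v ≡ᵇ z
... | true  = z≤n
... | false = ℕP.≤-refl
fixMono-weight z a (quad u w c) with u ≡ᵇ z
... | true  = s≤s z≤n
... | false with w ≡ᵇ z
...   | true  = s≤s z≤n
...   | false = ℕP.≤-refl

fixMono-weight-< : ∀ z a t → ¬ AbsentMono z t → weight (fixMono z a t) < degree t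
fixMono-weight-< z a (lin v c) present with v ≡ᵇ z | ≡ᵇ-reflects v z
... | true  | _        = s≤s z≤n
... | false | ofⁿ v≢z = ⊥-elim (present v≢z)
fixMono-weight-< z a (quad u w c) present with u ≡ᵇ z | ≡ᵇ-reflects u z
... | true  | _ = s≤s (s≤s z≤n)
... | false | ofⁿ u≢z with w ≡ᵇ z | ≡ᵇ-reflects w z
...   | true  | _        = s≤s (s≤s z≤n)
...   | false | ofⁿ w≢z = ⊥-elim (present (u≢z , w≢z))

absentMono? : ∀ z t → Dec (AbsentMono z t)
absentMono? z (lin y _)    = ¬? (y ℕ.≟ z)
absentMono? z (quad u w _) = ¬? (u ℕ.≟ z) ×-dec ¬? (w ℕ.≟ z)

fix-weight : ∀ z a f → weight (fix z a f) ≤ weight f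
fix-weight z a []      = z≤n
fix-weight z a (t ∷ f) rewrite weight-++ (fixMono z a t) (fix z a f) =
  ℕP.+-mono-≤ (fixMono-weight z a t) (fix-weight z a f)

fix-weight-< : ∀ z a f → ¬ Absent z f → weight (fix z a f) < weight f
fix-weight-< z a []      present = ⊥-elim (present [])
fix-weight-< z a (t ∷ f) present rewrite weight-++ (fixMono z a t) (fix z a f)
  with absentMono? z t
... | yes absent-t = ℕP.+-mono-≤-< (fixMono-weight z a t)
                       (fix-weight-< z a f (λ absent-f → present (absent-t ∷ absent-f)))
... | no  present-t = ℕP.+-mono-<-≤ (fixMono-weight-< z a t present-t) (fix-weight z a f)

total-vanish : ∀ {g} f → All (λ t → g t ≡ 0ℤ) f → total g f ≡ 0ℤ
total-vanish []      []         = refl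
total-vanish (t ∷ f) (e ∷ es) rewrite e | total-vanish f es = refl

absent-linCoef : ∀ {z} f → Absent z f → linCoef z f ≡ 0ℤ
absent-linCoef {z} f absent = total-vanish f (All.map vanishes absent)
  where
  vanishes : ∀ {t} → AbsentMono z t → linCoefMono z t ≡ 0ℤ
  vanishes {lin y c}    y≢z rewrite ≢⇒≡ᵇ-false y≢z = refl
  vanishes {quad _ _ _} _   = refl

absent-quadCoef : ∀ {z} y f → Absent z f → quadCoef z y f ≡ 0ℤ
absent-quadCoef {z} y f absent = total-vanish f (All.map vanishes absent)
  where
  vanishes : ∀ {t} → AbsentMono z t → quadCoefMono z y t ≡ 0ℤ
  vanishes {lin _ _}    _ = refl
  vanishes {quad u w c} (u≢z , w≢z)
    rewrite ≢⇒≡ᵇ-false u≢z | ≢⇒≡ᵇ-false w≢z = refl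

quadCoef-sym : ∀ x y f → quadCoef x y f ≡ quadCoef y x f
quadCoef-sym x y = total-cong′ swap
  where
  swap : ∀ t → quadCoefMono x y t ≡ quadCoefMono y x t
  swap (lin _ _)    = refl
  swap (quad u w c) rewrite ∧-comm (u ≡ᵇ x) (w ≡ᵇ y) | ∧-comm (w ≡ᵇ x) (u ≡ᵇ y) =
    ℤP.+-comm ([ (w ≡ᵇ y) ∧ (u ≡ᵇ x) ]· c) _

multilinear-quadCoef : ∀ z f → Multilinear f → quadCoef z z f ≡ 0ℤ
multilinear-quadCoef z f ml = total-vanish f (All.map vanishes ml)
  where
  vanishes : ∀ {t} → MultilinearMono t → quadCoefMono z z t ≡ 0ℤ
  vanishes {lin _ _} _ = refl
  vanishes {quad u w c} u≢w with u ≡ᵇ z | ≡ᵇ-reflects u z | w ≡ᵇ z | ≡ᵇ-reflects w z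
  ... | true  | ofʸ refl | true  | ofʸ refl = ⊥-elim (u≢w refl)
  ... | true  | _        | false | _        = refl
  ... | false | _        | true  | _        = refl
  ... | false | _        | false | _        = refl

mem-or-absent : ∀ z f → z ∈ vars f ⊎ Absent z f
mem-or-absent z [] = inj₂ []
mem-or-absent z (lin y c ∷ f) with y ℕ.≟ z | mem-or-absent z f
... | yes refl | _             = inj₁ (here refl)
... | no  y≢z  | inj₁ z∈f      = inj₁ (there z∈f)
... | no  y≢z  | inj₂ absent   = inj₂ (y≢z ∷ absent)
mem-or-absent z (quad u w c ∷ f) with u ℕ.≟ z | w ℕ.≟ z | mem-or-absent z f
... | yes refl | _        | _           = inj₁ (here refl)
... | no  _    | yes refl | _           = inj₁ (there (here refl))
... | no  _    | no  _    | inj₁ z∈f    = inj₁ (there (there z∈f))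
... | no  u≢z  | no  w≢z  | inj₂ absent = inj₂ ((u≢z , w≢z) ∷ absent)

update : Assignment → ℕ → Bool → Assignment
update α z b v = if v ≡ᵇ z then b else α v

update-same : ∀ α z b → update α z b z ≡ b
update-same α z b rewrite ≡ᵇ-refl z = refl

update-other : ∀ α z b {v} → v ≢ z → update α z b v ≡ α v
update-other α z b v≢z rewrite ≢⇒≡ᵇ-false v≢z = refl

absent-eval : ∀ {z} α b f → Absent z f → eval (update α z b) f ≡ eval α f
absent-eval {z} α b f absent = total-cong f (All.map unchanged absent)
  where
  unchanged : ∀ {t} → AbsentMono z t → evalMono (update α z b) t ≡ evalMono α t
  unchanged {lin y c}    y≢z = cong (λ v → c *ᶻ sg v) (update-other α z b y≢z)
  unchanged {quad u w c} (u≢z , w≢z) =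
    cong₂ (λ p q → c *ᶻ (sg p *ᶻ sg q)) (update-other α z b u≢z) (update-other α z b w≢z)

Occurs : Poly → ℕ → Set
Occurs f v = linCoef v f ≢ 0ℤ ⊎ ∃ λ u → quadCoef v u f ≢ 0ℤ

linCoef-mem : ∀ z f → linCoef z f ≢ 0ℤ → z ∈ vars f
linCoef-mem z f nonzero with mem-or-absent z f
... | inj₁ z∈f    = z∈f
... | inj₂ absent = ⊥-elim (nonzero (absent-linCoef f absent))

quadCoef-mem : ∀ v u f → quadCoef v u f ≢ 0ℤ → u ∈ vars f
quadCoef-mem v u f nonzero with mem-or-absent u f
... | inj₁ u∈f    = u∈f
... | inj₂ absent = ⊥-elim (nonzero (trans (quadCoef-sym v u f) (absent-quadCoef v f absent)))

occurs-mem : ∀ f v → Occurs f v → v ∈ vars f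
occurs-mem f v (inj₁ nonzero)      = linCoef-mem v f nonzero
occurs-mem f v (inj₂ (u , nonzero)) =
  quadCoef-mem u v f (λ e → nonzero (trans (quadCoef-sym v u f) e))

-- Occurrence is decidable: a partner u can only be a variable of f.
occurs? : ∀ f v → Dec (Occurs f v)
occurs? f v with linCoef v f ℤ.≟ 0ℤ
... | no nonzero = yes (inj₁ nonzero)
... | yes zero-lin with any? (λ u → ¬? (quadCoef v u f ℤ.≟ 0ℤ)) (vars f)
...   | yes partner = yes (inj₂ (find partner .proj₁ , find partner .proj₂ .proj₂))
...   | no  none    = no λ
  { (inj₁ nonzero)      → nonzero zero-lin
  ; (inj₂ (u , nonzero)) → none (lose (quadCoef-mem v u f nonzero) nonzero) }

keep-occurs : ∀ {z v} a f → v ≢ z → quadCoef z v f ≡ 0ℤ → Occurs f v → Occurs (fix z a f) v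
keep-occurs {z} {v} a f v≢z no-edge (inj₁ nonzero) = inj₁ λ e → nonzero (begin
  linCoef v f                          ≡⟨ vanish (linCoef v f) (sg a) ⟩
  linCoef v f +ᶻ sg a *ᶻ 0ℤ            ≡⟨ cong (λ q → linCoef v f +ᶻ sg a *ᶻ q) (sym no-edge) ⟩
  linCoef v f +ᶻ sg a *ᶻ quadCoef z v f ≡⟨ sym (fix-linCoef a f v≢z) ⟩
  linCoef v (fix z a f)                ≡⟨ e ⟩
  0ℤ                                   ∎)
  where open ≡-Reasoning
keep-occurs {z} {v} a f v≢z no-edge (inj₂ (u , nonzero)) with u ℕ.≟ z
... | yes refl = ⊥-elim (nonzero (trans (quadCoef-sym v u f) no-edge))
... | no  u≢z  = inj₂ (u , λ e → nonzero (trans (sym (fix-quadCoef a f v≢z u≢z)) e))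

sg-involutive : ∀ a q → sg a *ᶻ (sg a *ᶻ q) ≡ q
sg-involutive true  = solve-∀
sg-involutive false = solve-∀

-- A neighbour v of z survives fixing z if its own linear coefficient was 0
-- (it inherits a nonzero one) or it has a further neighbour besides z.
neighbour-survives : ∀ {z v} a f → v ≢ z → quadCoef z v f ≢ 0ℤ →
                     linCoef v f ≡ 0ℤ ⊎ (∃ λ u → u ≢ z × quadCoef v u f ≢ 0ℤ) →
                     Occurs (fix z a f) v
neighbour-survives {z} {v} a f v≢z edge (inj₁ zero-lin) = inj₁ λ e → edge (begin
  quadCoef z v f                                ≡⟨ sym (sg-involutive a _) ⟩
  sg a *ᶻ (sg a *ᶻ quadCoef z v f)              ≡⟨ cong (sg a *ᶻ_) (begin
    sg a *ᶻ quadCoef z v f                          ≡⟨ sym (ℤP.+-identityˡ _) ⟩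
    0ℤ +ᶻ sg a *ᶻ quadCoef z v f                    ≡⟨ cong (_+ᶻ sg a *ᶻ quadCoef z v f) (sym zero-lin) ⟩
    linCoef v f +ᶻ sg a *ᶻ quadCoef z v f           ≡⟨ sym (fix-linCoef a f v≢z) ⟩
    linCoef v (fix z a f)                           ≡⟨ e ⟩
    0ℤ                                              ∎) ⟩
  sg a *ᶻ 0ℤ                                    ≡⟨ ℤP.*-zeroʳ (sg a) ⟩
  0ℤ                                            ∎)
  where open ≡-Reasoning
neighbour-survives a f v≢z edge (inj₂ (u , u≢z , nonzero)) =
  inj₂ (u , λ e → nonzero (trans (sym (fix-quadCoef a f v≢z u≢z)) e))

AtMost : ℕ → (ℕ → Set) → Set
AtMost m N = ∀ ys → Unique ys → All N ys → length ys ≤ m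

module _ {P : ℕ → Set} (P? : Decidable P) where

  length-filter-split : ∀ xs → length xs ≡ length (filter P? xs) + length (filter (∁? P?) xs)
  length-filter-split []       = refl
  length-filter-split (x ∷ xs) with P? x
  ... | yes _ = cong suc (length-filter-split xs)
  ... | no  _ = trans (cong suc (length-filter-split xs)) (sym (ℕP.+-suc _ _))

  survivors : ∀ {N m} xs → Unique xs → All (λ v → P v ⊎ N v) xs → AtMost m N →
              length xs ≤ m + length (filter P? xs)
  survivors {N} {m} xs unique classified atMost = begin
    length xs                                          ≡⟨ length-filter-split xs ⟩
    length (filter P? xs) + length (filter (∁? P?) xs)  ≤⟨ ℕP.+-monoʳ-≤ (length (filter P? xs)) lost-bound ⟩
    length (filter P? xs) + m                          ≡⟨ ℕP.+-comm _ m ⟩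
    m + length (filter P? xs)                          ∎
    where
    open ℕP.≤-Reasoning
    lost-are-N : All N (filter (∁? P?) xs)
    lost-are-N = All.zipWith (λ { (inj₁ p , ¬p) → ⊥-elim (¬p p) ; (inj₂ n , _) → n })
                   (All.filter⁺ (∁? P?) classified , All.all-filter (∁? P?) xs)
    lost-bound : length (filter (∁? P?) xs) ≤ m
    lost-bound = atMost _ (Unique.filter⁺ (∁? P?) unique) lost-are-N

atMost-none : AtMost 0 (λ _ → ⊥)
atMost-none []      _ []      = z≤n

atMost-one : ∀ {N} → (∀ u w → N u → N w → u ≡ w) → AtMost 1 N
atMost-one same []                _                      _             = z≤n
atMost-one same (y ∷ [])          _                      _             = s≤s z≤n
atMost-one same (y ∷ y′ ∷ ys) ((y≢y′ ∷ _) ∷ _) (n ∷ n′ ∷ _) = ⊥-elim (y≢y′ (same y y′ n n′))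

atMost-suc : ∀ {N m} z → AtMost m N → AtMost (suc m) (λ v → v ≡ z ⊎ N v)
atMost-suc {N} {m} z atMost ys unique classified = begin
  length ys                                  ≤⟨ survivors (λ v → ¬? (v ℕ.≟ z)) ys unique swapped
                                                  (atMost-one (λ u w u≡z w≡z → trans u≡z (sym w≡z))) ⟩
  1 + length (filter (λ v → ¬? (v ℕ.≟ z)) ys) ≤⟨ s≤s (atMost _ (Unique.filter⁺ _ unique) others-are-N) ⟩
  suc m                                      ∎
  where
  open ℕP.≤-Reasoning
  swapped : All (λ v → v ≢ z ⊎ v ≡ z) ys
  swapped = All.universal decide ys
    where
    decide : ∀ v → v ≢ z ⊎ v ≡ z
    decide v with v ℕ.≟ z
    ... | yes v≡z = inj₂ v≡z
    ... | no  v≢z = inj₁ v≢z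
  others-are-N : All N (filter (λ v → ¬? (v ℕ.≟ z)) ys)
  others-are-N = All.zipWith (λ { (inj₁ v≡z , v≢z) → ⊥-elim (v≢z v≡z) ; (inj₂ n , _) → n })
                   (All.filter⁺ _ classified , All.all-filter _ ys)

Shrinks : Poly → Poly → ℕ → Set
Shrinks f g m = ∀ xs → Unique xs → All (Occurs f) xs →
                ∃ λ ys → Unique ys × All (Occurs g) ys × length xs ≤ m + length ys

shrinks-trans : ∀ {f g h m n} → Shrinks f g m → Shrinks g h n → Shrinks f h (m + n)
shrinks-trans {m = m} {n} fg gh xs unique occ with fg xs unique occ
... | ys , unique′ , occ′ , xs≤ with gh ys unique′ occ′
...   | zs , unique″ , occ″ , ys≤ = zs , unique″ , occ″ , (begin
  length xs                ≤⟨ xs≤ ⟩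
  m + length ys            ≤⟨ ℕP.+-monoʳ-≤ m ys≤ ⟩
  m + (n + length zs)      ≡⟨ sym (ℕP.+-assoc m n _) ⟩
  m + n + length zs        ∎)
  where open ℕP.≤-Reasoning

shrinks-empty : ∀ {f g} → (∀ v → ¬ Occurs f v) → Shrinks f g 0
shrinks-empty none []      _ _         = [] , [] , [] , z≤n
shrinks-empty none (x ∷ _) _ (occ ∷ _) = ⊥-elim (none x occ)

fix-shrinks : ∀ {N m} z a f → AtMost m N →
              (∀ v → v ≢ z → quadCoef z v f ≢ 0ℤ → Occurs (fix z a f) v ⊎ N v) →
              Shrinks f (fix z a f) (suc m)
fix-shrinks {N} z a f atMost neighbours xs unique occ =
  filter (occurs? f′) xs , Unique.filter⁺ (occurs? f′) unique , All.all-filter (occurs? f′) xs ,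
  survivors (occurs? f′) xs unique (All.map classify occ) (atMost-suc z atMost)
  where
  f′ = fix z a f
  classify : ∀ {v} → Occurs f v → Occurs f′ v ⊎ (v ≡ z ⊎ N v)
  classify {v} occ-v with occurs? f′ v | v ℕ.≟ z
  ... | yes occ′ | _        = inj₁ occ′
  ... | no  _    | yes v≡z  = inj₂ (inj₁ v≡z)
  ... | no  lost | no  v≢z with quadCoef z v f ℤ.≟ 0ℤ
  ...   | yes no-edge = ⊥-elim (lost (keep-occurs a f v≢z no-edge occ-v))
  ...   | no  edge    with neighbours v v≢z edge
  ...     | inj₁ occ′ = ⊥-elim (lost occ′)
  ...     | inj₂ n    = inj₂ (inj₂ n)

record Reduction (f : Poly) : Set where
  field
    poly        : Poly
    gain        : ℤ
    lost        : ℕ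
    extend      : Assignment → Assignment
    eval-extend : ∀ β → eval (extend β) f ≡ gain +ᶻ eval β poly
    multilinear : Multilinear poly
    smaller     : weight poly < weight f
    shrinks     : Shrinks f poly lost

fixing : ∀ {m} z a f → Multilinear f → ¬ Absent z f → Shrinks f (fix z a f) m → Reduction f
fixing {m} z a f ml present shrinks = record
  { poly        = fix z a f
  ; gain        = sg a *ᶻ linCoef z f
  ; lost        = m
  ; extend      = λ β → update β z a
  ; eval-extend = λ β → trans (fix-eval f (update-same β z a) ml)
                          (cong (sg a *ᶻ linCoef z f +ᶻ_) (absent-eval β a (fix z a f) (fix-absent z a ml)))
  ; multilinear = fix-multilinear z a ml
  ; smaller     = fix-weight-< z a f present
  ; shrinks     = shrinks
  }

_⨾_ : ∀ {f} (r : Reduction f) → Reduction (Reduction.poly r) → Reduction f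
_⨾_ {f} r s = record
  { poly        = S.poly
  ; gain        = R.gain +ᶻ S.gain
  ; lost        = R.lost + S.lost
  ; extend      = λ β → R.extend (S.extend β)
  ; eval-extend = λ β → trans (R.eval-extend (S.extend β))
                          (trans (cong (R.gain +ᶻ_) (S.eval-extend β)) (sym (ℤP.+-assoc R.gain S.gain _)))
  ; multilinear = S.multilinear
  ; smaller     = ℕP.<-trans S.smaller R.smaller
  ; shrinks     = shrinks-trans {f} {R.poly} {S.poly} R.shrinks S.shrinks
  }
  where
  module R = Reduction r
  module S = Reduction s

TwoNeighbours : Poly → ℕ → Set
TwoNeighbours f z = ∃ λ u → ∃ λ w → u ≢ w × quadCoef z u f ≢ 0ℤ × quadCoef z w f ≢ 0ℤ

distinctNeighbours? : ∀ f z u w → Dec (u ≢ w × quadCoef z u f ≢ 0ℤ × quadCoef z w f ≢ 0ℤ)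
distinctNeighbours? f z u w =
  ¬? (u ℕ.≟ w) ×-dec (¬? (quadCoef z u f ℤ.≟ 0ℤ) ×-dec ¬? (quadCoef z w f ℤ.≟ 0ℤ))

-- Neighbours are variables of f, so two of them can be searched for.
twoNeighbours? : ∀ f z → Dec (TwoNeighbours f z)
twoNeighbours? f z with any? (λ u → any? (distinctNeighbours? f z u) (vars f)) (vars f)
... | yes found = let u , _ , inner = find found ; w , _ , u≢w , eu , ew = find inner
                  in yes (u , w , u≢w , eu , ew)
... | no  none  = no λ (u , w , u≢w , eu , ew) →
  none (lose (quadCoef-mem z u f eu) (lose (quadCoef-mem z w f ew) (u≢w , eu , ew)))

positive-sign : ∀ l → l ≢ 0ℤ → ∃ λ a → 1ℤ ≤ᶻ sg a *ᶻ l
positive-sign (+ zero)  nonzero = ⊥-elim (nonzero refl)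
positive-sign (+ suc n) _       = true  , ℤ.+≤+ (s≤s z≤n)
positive-sign -[1+ n ]  _       = false , ℤ.+≤+ (s≤s z≤n)

gainingFix : ∀ {m} z f → Multilinear f → linCoef z f ≢ 0ℤ →
             (∀ a → Shrinks f (fix z a f) m) →
             Σ (Reduction f) λ r → 1ℤ ≤ᶻ Reduction.gain r × Reduction.lost r ≡ m
gainingFix z f ml nonzero shrinks =
  let a , gain≥1 = positive-sign (linCoef z f) nonzero
  in fixing z a f ml (λ absent → nonzero (absent-linCoef f absent)) (shrinks a) , gain≥1 , refl

-- If f has a variable with nonzero linear coefficient, some reduction gains
-- at least 1 while losing at most 2 variables: fix such a variable with at
-- most one neighbour if there is one (losing it and that neighbour); otherwise
-- fix the given z, whose neighbours all survive.
linearStep : ∀ f → Multilinear f → ∀ z → linCoef z f ≢ 0ℤ →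
             Σ (Reduction f) λ r → 1ℤ ≤ᶻ Reduction.gain r × Reduction.lost r ≤ 2
linearStep f ml z nonzero
  with any? (λ z′ → ¬? (linCoef z′ f ℤ.≟ 0ℤ) ×-dec ¬? (twoNeighbours? f z′)) (vars f)
... | yes found =
  let z′ , _ , nonzero′ , few = find found
      r , gain≥1 , lost≡2 = gainingFix z′ f ml nonzero′ λ a →
        fix-shrinks z′ a f (atMost-one (unique-neighbour few)) (λ v _ edge → inj₂ edge)
  in r , gain≥1 , ℕP.≤-reflexive lost≡2
  where
  unique-neighbour : ∀ {z′} → ¬ TwoNeighbours f z′ →
                     ∀ u w → quadCoef z′ u f ≢ 0ℤ → quadCoef z′ w f ≢ 0ℤ → u ≡ w
  unique-neighbour few u w eu ew with u ℕ.≟ w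
  ... | yes u≡w = u≡w
  ... | no  u≢w = ⊥-elim (few (u , w , u≢w , eu , ew))
... | no none =
  let r , gain≥1 , lost≡1 = gainingFix z f ml nonzero λ a →
        fix-shrinks z a f atMost-none (λ v v≢z edge → inj₁ (neighbour-survives a f v≢z edge (other v)))
  in r , gain≥1 , ℕP.≤-trans (ℕP.≤-reflexive lost≡1) (s≤s z≤n)
  where
  other : ∀ v → linCoef v f ≡ 0ℤ ⊎ (∃ λ u → u ≢ z × quadCoef v u f ≢ 0ℤ)
  other v with linCoef v f ℤ.≟ 0ℤ
  ... | yes zero-lin = inj₁ zero-lin
  ... | no  nonzero-v with twoNeighbours? f v
  ...   | no  few = ⊥-elim (none (lose (linCoef-mem v f nonzero-v) (nonzero-v , few)))
  ...   | yes (u , w , u≢w , eu , ew) with u ℕ.≟ z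
  ...     | no  u≢z  = inj₂ (u , u≢z , eu)
  ...     | yes refl = inj₂ (w , (λ w≡u → u≢w (sym w≡u)) , ew)

Fair : ∀ {f} → Reduction f → Set
Fair r = + Reduction.lost r ≤ᶻ + 3 *ᶻ Reduction.gain r

fair-if : ∀ {f} (r : Reduction f) → Reduction.lost r ≤ 3 → 1ℤ ≤ᶻ Reduction.gain r → Fair r
fair-if r lost≤3 gain≥1 = ℤP.≤-trans (ℤ.+≤+ lost≤3) (ℤP.*-monoˡ-≤-nonNeg (+ 3) gain≥1)

firstVar : Mono → ℕ
firstVar (lin y _)    = y
firstVar (quad u _ _) = u

firstVar-present : ∀ t f → ¬ Absent (firstVar t) (t ∷ f)
firstVar-present (lin y _)    f (y≢y ∷ _)     = y≢y refl
firstVar-present (quad u _ _) f ((u≢u , _) ∷ _) = u≢u refl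

linear-zero-everywhere : ∀ f → ¬ Any (λ z → linCoef z f ≢ 0ℤ) (vars f) → ∀ z → linCoef z f ≡ 0ℤ
linear-zero-everywhere f noLinear z with linCoef z f ℤ.≟ 0ℤ
... | yes zero-lin = zero-lin
... | no  nonzero  = ⊥-elim (noLinear (lose (linCoef-mem z f nonzero) nonzero))

-- All linear coefficients vanish but Q_zu ≠ 0.  Fixing z gains nothing and
-- loses only z, since every neighbour inherits a nonzero linear coefficient;
-- in particular u does, and a linearStep follows.  Together: gain ≥ 1 and
-- loss ≤ 3.
quadraticStep : ∀ f → Multilinear f → (∀ v → linCoef v f ≡ 0ℤ) →
                ∀ {z u} → quadCoef z u f ≢ 0ℤ → Σ (Reduction f) Fair
quadraticStep f ml linear-zero {z} {u} edge = r₁ ⨾ proj₁ step , fair-if (r₁ ⨾ proj₁ step) lost≤3 gain≥1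
  where
  u≢z : u ≢ z
  u≢z refl = edge (multilinear-quadCoef u f ml)
  r₁ = fixing z true f ml (λ absent → edge (absent-quadCoef u f absent))
         (fix-shrinks z true f atMost-none
            (λ v v≢z edge′ → inj₁ (neighbour-survives true f v≢z edge′ (inj₁ (linear-zero v)))))
  u-linear : linCoef u (fix z true f) ≢ 0ℤ
  u-linear e = edge (begin
    quadCoef z u f                          ≡⟨ sym (ℤP.*-identityˡ _) ⟩
    1ℤ *ᶻ quadCoef z u f                    ≡⟨ sym (ℤP.+-identityˡ _) ⟩
    0ℤ +ᶻ 1ℤ *ᶻ quadCoef z u f              ≡⟨ cong (_+ᶻ 1ℤ *ᶻ quadCoef z u f) (sym (linear-zero u)) ⟩
    linCoef u f +ᶻ 1ℤ *ᶻ quadCoef z u f     ≡⟨ sym (fix-linCoef true f u≢z) ⟩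
    linCoef u (fix z true f)                ≡⟨ e ⟩
    0ℤ                                      ∎)
    where open ≡-Reasoning
  step = linearStep (fix z true f) (fix-multilinear z true ml) u u-linear
  lost≤3 : 1 + Reduction.lost (proj₁ step) ≤ 3
  lost≤3 = s≤s (proj₂ (proj₂ step))
  gain≥1 : 1ℤ ≤ᶻ 1ℤ *ᶻ linCoef z f +ᶻ Reduction.gain (proj₁ step)
  gain≥1 rewrite linear-zero z = ℤP.≤-trans (proj₁ (proj₂ step)) (ℤP.≤-reflexive (sym (ℤP.+-identityˡ _)))

-- No variable occurs: fixing any variable loses nothing and gains nothing.
vacuousStep : ∀ t f → Multilinear (t ∷ f) → (∀ v → linCoef v (t ∷ f) ≡ 0ℤ) →
              (∀ v → ¬ Occurs (t ∷ f) v) → Σ (Reduction (t ∷ f)) Fair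
vacuousStep t f ml linear-zero nothing-occurs = r , fair
  where
  x = firstVar t
  r = fixing x true (t ∷ f) ml (firstVar-present t f) (shrinks-empty {t ∷ f} {fix x true (t ∷ f)} nothing-occurs)
  fair : Fair r
  fair rewrite linear-zero x = ℤP.≤-refl

reduce : ∀ t f → Multilinear (t ∷ f) → Σ (Reduction (t ∷ f)) Fair
reduce t f ml with any? (λ z → ¬? (linCoef z (t ∷ f) ℤ.≟ 0ℤ)) (vars (t ∷ f))
... | yes found =
  let z , _ , nonzero = find found ; r , gain≥1 , lost≤2 = linearStep (t ∷ f) ml z nonzero
  in r , fair-if r (ℕP.m≤n⇒m≤1+n lost≤2) gain≥1
... | no noLinear with any? (occurs? (t ∷ f)) (vars (t ∷ f))
...   | no noOccurrence =
  vacuousStep t f ml (linear-zero-everywhere (t ∷ f) noLinear)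
              (λ v occ → noOccurrence (lose (occurs-mem (t ∷ f) v occ) occ))
...   | yes found with find found
...     | z , _ , inj₁ nonzero = ⊥-elim (nonzero (linear-zero-everywhere (t ∷ f) noLinear z))
...     | z , _ , inj₂ (u , edge) = quadraticStep (t ∷ f) ml (linear-zero-everywhere (t ∷ f) noLinear) edge

transfer : ∀ {f} (r : Reduction f) → Fair r → ∀ {xs ys : List ℕ} →
           length xs ≤ Reduction.lost r + length ys → ∀ β →
           + length ys ≤ᶻ + 3 *ᶻ eval β (Reduction.poly r) →
           + length xs ≤ᶻ + 3 *ᶻ eval (Reduction.extend r β) f
transfer {f} r fair {xs} {ys} xs≤ β ys-bound = begin
  + length xs                           ≤⟨ ℤ.+≤+ xs≤ ⟩
  + (R.lost + length ys)                ≡⟨ ℤP.pos-+ R.lost (length ys) ⟩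
  + R.lost +ᶻ + length ys               ≤⟨ ℤP.+-mono-≤ fair ys-bound ⟩
  + 3 *ᶻ R.gain +ᶻ + 3 *ᶻ eval β R.poly ≡⟨ sym (ℤP.*-distribˡ-+ (+ 3) R.gain _) ⟩
  + 3 *ᶻ (R.gain +ᶻ eval β R.poly)      ≡⟨ cong (+ 3 *ᶻ_) (sym (R.eval-extend β)) ⟩
  + 3 *ᶻ eval (R.extend β) f            ∎
  where
  module R = Reduction r
  open ℤP.≤-Reasoning

-- Induction on the weight
-- (bounded by n), applying a fair reduction at each step.
lowerBound : ∀ n f → weight f < n → Multilinear f → ∀ xs → Unique xs → All (Occurs f) xs →
             ∃ λ α → + length xs ≤ᶻ + 3 *ᶻ eval α f
lowerBound (suc n) [] _ _ [] _ [] = (λ _ → true) , ℤP.≤-refl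
lowerBound (suc n) [] _ _ (x ∷ _) _ (inj₁ nonzero ∷ _)       = ⊥-elim (nonzero refl)
lowerBound (suc n) [] _ _ (x ∷ _) _ (inj₂ (_ , nonzero) ∷ _) = ⊥-elim (nonzero refl)
lowerBound (suc n) (t ∷ f) weight< ml xs unique occ with reduce t f ml
... | r , fair with Reduction.shrinks r xs unique occ
...   | ys , unique′ , occ′ , xs≤
      with lowerBound n (Reduction.poly r) (ℕP.<-≤-trans (Reduction.smaller r) (ℕ.s≤s⁻¹ weight<))
                      (Reduction.multilinear r) ys unique′ occ′
...     | β , ys-bound = Reduction.extend r β , transfer r fair {xs} {ys} xs≤ β ys-bound

-- A clause pq is satisfied
-- exactly when  (3 + s_p·x_p + s_q·x_q − s_p·s_q·x_p·x_q)/4  equals 1,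
-- where s is the sign of a literal and x the ±1 value of its variable.
litSign : Lit → ℤ
litSign (pos _) = 1ℤ
litSign (neg _) = -1ℤ

clausePoly : Clause → Poly
clausePoly C =
  lin (var (l₁ C)) (litSign (l₁ C)) ∷ lin (var (l₂ C)) (litSign (l₂ C)) ∷
  quad (var (l₁ C)) (var (l₂ C)) (ℤ.- (litSign (l₁ C) *ᶻ litSign (l₂ C))) ∷ []

formulaPoly : Formula → Poly
formulaPoly = concatMap clausePoly

formulaPoly-multilinear : ∀ F → Multilinear (formulaPoly F)
formulaPoly-multilinear []      = []
formulaPoly-multilinear (C ∷ F) = tt ∷ tt ∷ distinct C ∷ formulaPoly-multilinear F

ind : Bool → ℕ
ind b = if b then 1 else 0

literal-value : ∀ α l → litSign l *ᶻ sg (α (var l)) ≡ sg (litVal α l)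
literal-value α (pos x) = ℤP.*-identityˡ _
literal-value α (neg x) with α x
... | true  = refl
... | false = refl

disjunction-value : ∀ u w → + (4 * ind (u ∨ w)) ≡ + 3 +ᶻ (sg u +ᶻ (sg w +ᶻ (ℤ.- (sg u *ᶻ sg w) +ᶻ 0ℤ)))
disjunction-value true  true  = refl
disjunction-value true  false = refl
disjunction-value false true  = refl
disjunction-value false false = refl

clause-value : ∀ α C → + (4 * ind (satisfies α C)) ≡ + 3 +ᶻ eval α (clausePoly C)
clause-value α C = begin
  + (4 * ind (satisfies α C))
    ≡⟨ disjunction-value (litVal α (l₁ C)) (litVal α (l₂ C)) ⟩
  + 3 +ᶻ (sg u +ᶻ (sg w +ᶻ (ℤ.- (sg u *ᶻ sg w) +ᶻ 0ℤ)))
    ≡⟨ cong (+ 3 +ᶻ_) (sym (cong₂ expansion (literal-value α (l₁ C)) (literal-value α (l₂ C)))) ⟩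
  + 3 +ᶻ expansion (s₁ *ᶻ x₁) (s₂ *ᶻ x₂)
    ≡⟨ cong (+ 3 +ᶻ_) (regroup s₁ s₂ x₁ x₂) ⟩
  + 3 +ᶻ eval α (clausePoly C)
    ∎
  where
  open ≡-Reasoning
  u = litVal α (l₁ C) ; w = litVal α (l₂ C)
  s₁ = litSign (l₁ C) ; s₂ = litSign (l₂ C)
  x₁ = sg (α (var (l₁ C))) ; x₂ = sg (α (var (l₂ C)))
  expansion : ℤ → ℤ → ℤ
  expansion p q = p +ᶻ (q +ᶻ (ℤ.- (p *ᶻ q) +ᶻ 0ℤ))
  regroup : ∀ s₁ s₂ x₁ x₂ →
            s₁ *ᶻ x₁ +ᶻ (s₂ *ᶻ x₂ +ᶻ (ℤ.- (s₁ *ᶻ x₁ *ᶻ (s₂ *ᶻ x₂)) +ᶻ 0ℤ)) ≡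
            s₁ *ᶻ x₁ +ᶻ (s₂ *ᶻ x₂ +ᶻ (ℤ.- (s₁ *ᶻ s₂) *ᶻ (x₁ *ᶻ x₂) +ᶻ 0ℤ))
  regroup = solve-∀

numSat-eval : ∀ α F → + (4 * numSat α F) ≡ + (3 * size F) +ᶻ eval α (formulaPoly F)
numSat-eval α []      = refl
numSat-eval α (C ∷ F) = begin
  + (4 * (ind (satisfies α C) + numSat α F))
    ≡⟨ cong +_ (ℕP.*-distribˡ-+ 4 (ind (satisfies α C)) (numSat α F)) ⟩
  + (4 * ind (satisfies α C) + 4 * numSat α F)
    ≡⟨ ℤP.pos-+ (4 * ind (satisfies α C)) _ ⟩
  + (4 * ind (satisfies α C)) +ᶻ + (4 * numSat α F)
    ≡⟨ cong₂ _+ᶻ_ (clause-value α C) (numSat-eval α F) ⟩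
  (+ 3 +ᶻ eval α (clausePoly C)) +ᶻ (+ (3 * size F) +ᶻ eval α (formulaPoly F))
    ≡⟨ interchange (+ 3) (eval α (clausePoly C)) (+ (3 * size F)) _ ⟩
  (+ 3 +ᶻ + (3 * size F)) +ᶻ (eval α (clausePoly C) +ᶻ eval α (formulaPoly F))
    ≡⟨ cong₂ _+ᶻ_ (trans (sym (ℤP.pos-+ 3 (3 * size F))) (cong +_ (sym (ℕP.*-suc 3 (size F)))))
                  (sym (total-++ (evalMono α) (clausePoly C) (formulaPoly F))) ⟩
  + (3 * size (C ∷ F)) +ᶻ eval α (formulaPoly (C ∷ F))
    ∎
  where open ≡-Reasoning

when : Bool → Lit → List Lit
when b m = if b then m ∷ [] else []

partners : Lit → Clause → List Lit
partners p C = when (l₁ C ==L p) (l₂ C) ++ when (l₂ C ==L p) (l₁ C)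

allPartners : Lit → Formula → List Lit
allPartners p = concatMap (partners p)

count : Lit → List Lit → ℕ
count ℓ []       = 0
count ℓ (m ∷ ms) = ind (m ==L ℓ) + count ℓ ms

count-++ : ∀ ℓ xs ys → count ℓ (xs ++ ys) ≡ count ℓ xs + count ℓ ys
count-++ ℓ []       ys = refl
count-++ ℓ (m ∷ xs) ys rewrite count-++ ℓ xs ys = sym (ℕP.+-assoc (ind (m ==L ℓ)) _ _)

count-when : ∀ ℓ b m → count ℓ (when b m) ≡ ind (b ∧ (m ==L ℓ))
count-when ℓ true  m = ℕP.+-identityʳ _
count-when ℓ false m = refl

length-when : ∀ b m → length (when b m) ≡ ind b
length-when true  m = refl
length-when false m = refl

==L-sound : ∀ l m → T (l ==L m) → l ≡ m
==L-sound (pos x) (pos y) eq = cong pos (≡ᵇ⇒≡ x y eq)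
==L-sound (neg x) (neg y) eq = cong neg (≡ᵇ⇒≡ x y eq)

==L-refl : ∀ l → T (l ==L l)
==L-refl (pos x) = ≡⇒≡ᵇ x x refl
==L-refl (neg x) = ≡⇒≡ᵇ x x refl

ind-exclusive : ∀ b₁ b₂ b₃ b₄ → (T b₁ → T b₄ → ⊥) →
                ind ((b₁ ∧ b₂) ∨ (b₃ ∧ b₄)) ≡ ind (b₁ ∧ b₂) + ind (b₄ ∧ b₃)
ind-exclusive true  _     _     true  excl = ⊥-elim (excl tt tt)
ind-exclusive true  true  _     false _    = refl
ind-exclusive true  false true  false _    = refl
ind-exclusive true  false false false _    = refl
ind-exclusive false _     b₃    b₄    _    = cong ind (∧-comm b₃ b₄)

clause-occ : ∀ p ℓ C → ind (isClause p ℓ C) ≡ count ℓ (partners p C)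
clause-occ p ℓ C = begin
  ind (isClause p ℓ C)
    ≡⟨ ind-exclusive (l₁ C ==L p) (l₂ C ==L ℓ) (l₁ C ==L ℓ) (l₂ C ==L p) both-p ⟩
  ind ((l₁ C ==L p) ∧ (l₂ C ==L ℓ)) + ind ((l₂ C ==L p) ∧ (l₁ C ==L ℓ))
    ≡⟨ sym (cong₂ _+_ (count-when ℓ (l₁ C ==L p) (l₂ C)) (count-when ℓ (l₂ C ==L p) (l₁ C))) ⟩
  count ℓ (when (l₁ C ==L p) (l₂ C)) + count ℓ (when (l₂ C ==L p) (l₁ C))
    ≡⟨ sym (count-++ ℓ (when (l₁ C ==L p) (l₂ C)) _) ⟩
  count ℓ (partners p C)
    ∎
  where
  open ≡-Reasoning
  both-p : T (l₁ C ==L p) → T (l₂ C ==L p) → ⊥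
  both-p e₁ e₂ = distinct C (cong var (trans (==L-sound (l₁ C) p e₁) (sym (==L-sound (l₂ C) p e₂))))

occ-partners : ∀ F p ℓ → occ F p ℓ ≡ count ℓ (allPartners p F)
occ-partners []      p ℓ = refl
occ-partners (C ∷ F) p ℓ =
  trans (cong₂ _+_ (clause-occ p ℓ C) (occ-partners F p ℓ))
        (sym (count-++ ℓ (partners p C) (allPartners p F)))

when-mem : ∀ {b m l} → m ∈ when b l → T b × m ≡ l
when-mem {true} (here m≡l) = tt , m≡l

partners-mem : ∀ {p m} C → m ∈ partners p C → p ∈C C × m ∈C C
partners-mem {p} C m∈ with ∈-++⁻ (when (l₁ C ==L p) (l₂ C)) m∈
... | inj₁ m∈₁ = let b , m≡ = when-mem m∈₁ in inj₁ (sym (==L-sound _ _ b)) , inj₂ m≡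
... | inj₂ m∈₂ = let b , m≡ = when-mem m∈₂ in inj₂ (sym (==L-sound _ _ b)) , inj₁ m≡

allPartners-mem : ∀ {p m} F → m ∈ allPartners p F →
                  ∃ λ (i : Fin (length F)) → p ∈C lookup F i × m ∈C lookup F i
allPartners-mem {p} (C ∷ F) m∈ with ∈-++⁻ (partners p C) m∈
... | inj₁ m∈C = Fin.zero , partners-mem C m∈C
... | inj₂ m∈F = let i , mem = allPartners-mem F m∈F in Fin.suc i , mem

sum-identities : ∀ a a′ {b b′ c c′} → a +ᶻ b ≡ c → a′ +ᶻ b′ ≡ c′ → (a +ᶻ a′) +ᶻ (b +ᶻ b′) ≡ c +ᶻ c′
sum-identities a a′ {b} {b′} e e′ = trans (interchange a a′ b b′) (cong₂ _+ᶻ_ e e′)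

literal-linear : ∀ x l → [ var l ≡ᵇ x ]· litSign l +ᶻ + ind (l ==L neg x) ≡ + ind (l ==L pos x)
literal-linear x (pos a) with a ≡ᵇ x
... | true  = refl
... | false = refl
literal-linear x (neg a) with a ≡ᵇ x
... | true  = refl
... | false = refl

length-partners : ∀ p C → + length (partners p C) ≡ + ind (l₁ C ==L p) +ᶻ + ind (l₂ C ==L p)
length-partners p C rewrite length-++ (when (l₁ C ==L p) (l₂ C)) {when (l₂ C ==L p) (l₁ C)}
                          | length-when (l₁ C ==L p) (l₂ C) | length-when (l₂ C ==L p) (l₁ C) =
  ℤP.pos-+ (ind (l₁ C ==L p)) _

clause-linear : ∀ x C → linCoef x (clausePoly C) +ᶻ + length (partners (neg x) C) ≡ + length (partners (pos x) C)
clause-linear x C = begin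
  linCoef x (clausePoly C) +ᶻ + length (partners (neg x) C)
    ≡⟨ cong₂ _+ᶻ_ (cong (coef₁ +ᶻ_) (ℤP.+-identityʳ coef₂)) (length-partners (neg x) C) ⟩
  (coef₁ +ᶻ coef₂) +ᶻ (+ ind (l₁ C ==L neg x) +ᶻ + ind (l₂ C ==L neg x))
    ≡⟨ sum-identities coef₁ coef₂ (literal-linear x (l₁ C)) (literal-linear x (l₂ C)) ⟩
  + ind (l₁ C ==L pos x) +ᶻ + ind (l₂ C ==L pos x)
    ≡⟨ sym (length-partners (pos x) C) ⟩
  + length (partners (pos x) C)
    ∎
  where
  open ≡-Reasoning
  coef₁ = [ var (l₁ C) ≡ᵇ x ]· litSign (l₁ C)
  coef₂ = [ var (l₂ C) ≡ᵇ x ]· litSign (l₂ C)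

linear-partners : ∀ x F → linCoef x (formulaPoly F) +ᶻ + length (allPartners (neg x) F) ≡ + length (allPartners (pos x) F)
linear-partners x []      = refl
linear-partners x (C ∷ F)
  rewrite total-++ (linCoefMono x) (clausePoly C) (formulaPoly F)
        | length-++ (partners (neg x) C) {allPartners (neg x) F}
        | length-++ (partners (pos x) C) {allPartners (pos x) F}
        | ℤP.pos-+ (length (partners (neg x) C)) (length (allPartners (neg x) F))
        | ℤP.pos-+ (length (partners (pos x) C)) (length (allPartners (pos x) F)) =
  sum-identities (linCoef x (clausePoly C)) (linCoef x (formulaPoly F))
                 (clause-linear x C) (linear-partners x F)

sum-pairs : ∀ q q′ a a′ b b′ c c′ d d′ → q +ᶻ + (a + b) ≡ + (c + d) → q′ +ᶻ + (a′ + b′) ≡ + (c′ + d′) →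
            (q +ᶻ q′) +ᶻ + ((a + a′) + (b + b′)) ≡ + ((c + c′) + (d + d′))
sum-pairs q q′ a a′ b b′ c c′ d d′ e e′ = begin
  (q +ᶻ q′) +ᶻ + ((a + a′) + (b + b′))     ≡⟨ cong (λ n → (q +ᶻ q′) +ᶻ + n) (interchangeℕ a a′ b b′) ⟩
  (q +ᶻ q′) +ᶻ (+ (a + b) +ᶻ + (a′ + b′))  ≡⟨ sum-identities q q′ e e′ ⟩
  + ((c + d) + (c′ + d′))                  ≡⟨ cong +_ (interchangeℕ c d c′ d′) ⟩
  + ((c + c′) + (d + d′))                  ∎
  where
  open ≡-Reasoning
  interchangeℕ : ∀ a b c d → (a + b) + (c + d) ≡ (a + c) + (b + d)
  interchangeℕ = solveℕ

literal-pair : ∀ x v p q →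
  [ (var p ≡ᵇ x) ∧ (var q ≡ᵇ v) ]· (ℤ.- (litSign p *ᶻ litSign q)) +ᶻ
    (+ ind ((p ==L pos x) ∧ (q ==L pos v)) +ᶻ + ind ((p ==L neg x) ∧ (q ==L neg v)))
  ≡ + ind ((p ==L pos x) ∧ (q ==L neg v)) +ᶻ + ind ((p ==L neg x) ∧ (q ==L pos v))
literal-pair x v (pos a) (pos b) with a ≡ᵇ x | b ≡ᵇ v
... | true  | true  = refl
... | true  | false = refl
... | false | _     = refl
literal-pair x v (pos a) (neg b) with a ≡ᵇ x | b ≡ᵇ v
... | true  | true  = refl
... | true  | false = refl
... | false | _     = refl
literal-pair x v (neg a) (pos b) with a ≡ᵇ x | b ≡ᵇ v
... | true  | true  = refl
... | true  | false = refl
... | false | _     = refl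
literal-pair x v (neg a) (neg b) with a ≡ᵇ x | b ≡ᵇ v
... | true  | true  = refl
... | true  | false = refl
... | false | _     = refl

count-partners : ∀ ℓ p C →
  count ℓ (partners p C) ≡ ind ((l₁ C ==L p) ∧ (l₂ C ==L ℓ)) + ind ((l₂ C ==L p) ∧ (l₁ C ==L ℓ))
count-partners ℓ p C =
  trans (count-++ ℓ (when (l₁ C ==L p) (l₂ C)) (when (l₂ C ==L p) (l₁ C)))
        (cong₂ _+_ (count-when ℓ (l₁ C ==L p) (l₂ C)) (count-when ℓ (l₂ C ==L p) (l₁ C)))

clause-quad : ∀ x v C →
  quadCoef x v (clausePoly C) +ᶻ + (count (pos v) (partners (pos x) C) + count (neg v) (partners (neg x) C))
  ≡ + (count (neg v) (partners (pos x) C) + count (pos v) (partners (neg x) C))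
clause-quad x v C = begin
  quadCoef x v (clausePoly C) +ᶻ + (count (pos v) (partners (pos x) C) + count (neg v) (partners (neg x) C))
    ≡⟨ cong₂ _+ᶻ_ expand (cong +_ (cong₂ _+_ (count-partners (pos v) (pos x) C) (count-partners (neg v) (neg x) C))) ⟩
  (q₁₂ +ᶻ q₂₁) +ᶻ + ((pairs (pos x) (pos v) l₁′ l₂′ + pairs (pos x) (pos v) l₂′ l₁′) +
                    (pairs (neg x) (neg v) l₁′ l₂′ + pairs (neg x) (neg v) l₂′ l₁′))
    ≡⟨ sum-pairs q₁₂ q₂₁ (pairs (pos x) (pos v) l₁′ l₂′) (pairs (pos x) (pos v) l₂′ l₁′)
                 (pairs (neg x) (neg v) l₁′ l₂′) (pairs (neg x) (neg v) l₂′ l₁′)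
                 (pairs (pos x) (neg v) l₁′ l₂′) (pairs (pos x) (neg v) l₂′ l₁′)
                 (pairs (neg x) (pos v) l₁′ l₂′) (pairs (neg x) (pos v) l₂′ l₁′)
                 (literal-pair x v l₁′ l₂′) (literal-pair x v l₂′ l₁′) ⟩
  + ((pairs (pos x) (neg v) l₁′ l₂′ + pairs (pos x) (neg v) l₂′ l₁′) +
     (pairs (neg x) (pos v) l₁′ l₂′ + pairs (neg x) (pos v) l₂′ l₁′))
    ≡⟨ sym (cong +_ (cong₂ _+_ (count-partners (neg v) (pos x) C) (count-partners (pos v) (neg x) C))) ⟩
  + (count (neg v) (partners (pos x) C) + count (pos v) (partners (neg x) C))
    ∎
  where
  open ≡-Reasoning
  l₁′ = l₁ C ; l₂′ = l₂ C
  pairs : Lit → Lit → Lit → Lit → ℕ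
  pairs p ℓ m n = ind ((m ==L p) ∧ (n ==L ℓ))
  q₁₂ = [ (var l₁′ ≡ᵇ x) ∧ (var l₂′ ≡ᵇ v) ]· (ℤ.- (litSign l₁′ *ᶻ litSign l₂′))
  q₂₁ = [ (var l₂′ ≡ᵇ x) ∧ (var l₁′ ≡ᵇ v) ]· (ℤ.- (litSign l₂′ *ᶻ litSign l₁′))
  expand : quadCoef x v (clausePoly C) ≡ q₁₂ +ᶻ q₂₁
  expand = trans (ℤP.+-identityˡ _) (trans (ℤP.+-identityˡ _) (trans (ℤP.+-identityʳ _)
             (cong (λ c → q₁₂ +ᶻ [ (var l₂′ ≡ᵇ x) ∧ (var l₁′ ≡ᵇ v) ]· (ℤ.- c)) (ℤP.*-comm (litSign l₁′) _))))

quad-partners : ∀ x v F →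
  quadCoef x v (formulaPoly F) +ᶻ + (count (pos v) (allPartners (pos x) F) + count (neg v) (allPartners (neg x) F))
  ≡ + (count (neg v) (allPartners (pos x) F) + count (pos v) (allPartners (neg x) F))
quad-partners x v []      = refl
quad-partners x v (C ∷ F) = begin
  quadCoef x v (formulaPoly (C ∷ F)) +ᶻ + (count (pos v) (allPartners (pos x) (C ∷ F)) + count (neg v) (allPartners (neg x) (C ∷ F)))
    ≡⟨ cong₂ _+ᶻ_ (total-++ (quadCoefMono x v) (clausePoly C) (formulaPoly F))
                  (cong +_ (cong₂ _+_ (split (pos v) (pos x)) (split (neg v) (neg x)))) ⟩
  (quadCoef x v (clausePoly C) +ᶻ quadCoef x v (formulaPoly F)) +ᶻ
    + ((inC (pos v) (pos x) + inF (pos v) (pos x)) + (inC (neg v) (neg x) + inF (neg v) (neg x)))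
    ≡⟨ sum-pairs (quadCoef x v (clausePoly C)) (quadCoef x v (formulaPoly F))
                 (inC (pos v) (pos x)) (inF (pos v) (pos x)) (inC (neg v) (neg x)) (inF (neg v) (neg x))
                 (inC (neg v) (pos x)) (inF (neg v) (pos x)) (inC (pos v) (neg x)) (inF (pos v) (neg x))
                 (clause-quad x v C) (quad-partners x v F) ⟩
  + ((inC (neg v) (pos x) + inF (neg v) (pos x)) + (inC (pos v) (neg x) + inF (pos v) (neg x)))
    ≡⟨ sym (cong +_ (cong₂ _+_ (split (neg v) (pos x)) (split (pos v) (neg x)))) ⟩
  + (count (neg v) (allPartners (pos x) (C ∷ F)) + count (pos v) (allPartners (neg x) (C ∷ F)))
    ∎
  where
  open ≡-Reasoning
  inC : Lit → Lit → ℕ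
  inC ℓ p = count ℓ (partners p C)
  inF : Lit → Lit → ℕ
  inF ℓ p = count ℓ (allPartners p F)
  split : ∀ ℓ p → count ℓ (allPartners p (C ∷ F)) ≡ inC ℓ p + inF ℓ p
  split ℓ p = count-++ ℓ (partners p C) (allPartners p F)

==L-reflects : ∀ l m → Reflects (l ≡ m) (l ==L m)
==L-reflects l m = fromEquivalence (==L-sound l m) λ { refl → ==L-refl l }

count-mem : ∀ ℓ xs → 0 < count ℓ xs → ℓ ∈ xs
count-mem ℓ (m ∷ ms) positive with m ==L ℓ | ==L-reflects m ℓ
... | true  | ofʸ m≡ℓ = here (sym m≡ℓ)
... | false | _       = there (count-mem ℓ ms positive)

mem-count : ∀ {ℓ xs} → ℓ ∈ xs → 0 < count ℓ xs
mem-count {ℓ} (here refl) with ℓ ==L ℓ | ==L-reflects ℓ ℓ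
... | true  | _       = s≤s z≤n
... | false | ofⁿ ℓ≢ℓ = ⊥-elim (ℓ≢ℓ refl)
mem-count {ℓ} {m ∷ _} (there ℓ∈) = ℕP.<-≤-trans (mem-count ℓ∈) (ℕP.m≤n+m _ (ind (m ==L ℓ)))

remove : ∀ {b} A → b ∈ A →
         ∃ λ A′ → length A ≡ suc (length A′) × ∀ ℓ → count ℓ A ≡ ind (b ==L ℓ) + count ℓ A′
remove (a ∷ A) (here refl) = A , refl , λ ℓ → refl
remove {b} (a ∷ A) (there b∈A) =
  let A′ , length≡ , count≡ = remove A b∈A
  in a ∷ A′ , cong suc length≡ ,
     λ ℓ → trans (cong (λ n → ind (a ==L ℓ) + n) (count≡ ℓ)) (left-comm (ind (a ==L ℓ)) (ind (b ==L ℓ)) (count ℓ A′))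
  where
  left-comm : ∀ x y z → x + (y + z) ≡ y + (x + z)
  left-comm = solveℕ

dominance : ∀ B A → (∀ ℓ → count ℓ B ≤ count ℓ A) → ∀ y → count y B < count y A → length B < length A
dominance []      []      _      y ()
dominance []      (a ∷ A) _      y _  = s≤s z≤n
dominance (b ∷ B) A       le     y lt with remove A (count-mem b A (ℕP.<-≤-trans (mem-count {b} {b ∷ B} (here refl)) (le b)))
... | A′ , length≡ , count≡ = subst (length (b ∷ B) <_) (sym length≡) (s≤s (dominance B A′ le′ y lt′))
  where
  le′ : ∀ ℓ → count ℓ B ≤ count ℓ A′
  le′ ℓ = ℕP.+-cancelˡ-≤ (ind (b ==L ℓ)) _ _ (subst (count ℓ (b ∷ B) ≤_) (count≡ ℓ) (le ℓ))
  lt′ : count y B < count y A′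
  lt′ = ℕP.+-cancelˡ-< (ind (b ==L y)) _ _ (subst (count y (b ∷ B) <_) (count≡ y) lt)

compl-involutive : ∀ l → compl (compl l) ≡ l
compl-involutive (pos _) = refl
compl-involutive (neg _) = refl

Balanced : List Lit → List Lit → Set
Balanced A B = ∀ ℓ → count ℓ A + count (compl ℓ) B ≡ count (compl ℓ) A + count ℓ B

balanced-sym : ∀ {A B} → Balanced A B → Balanced B A
balanced-sym {A} {B} balanced ℓ with balanced (compl ℓ)
... | e rewrite compl-involutive ℓ =
  trans (ℕP.+-comm (count ℓ B) _) (trans e (ℕP.+-comm (count ℓ A) _))

-- The multiset lemma: for balanced lists of equal length, a literal y that
-- is more frequent in A forces ȳ into A and a complementary pair into B.
-- Otherwise B would be dominated by A, strictly at y, hence shorter.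
complementary-pair : ∀ A B y → length A ≡ length B → Balanced A B → count y B < count y A →
                     compl y ∈ A × ∃ λ w → w ∈ B × compl w ∈ B
complementary-pair A B y length≡ balanced lt = compl-y∈A , pair
  where
  compl-y∈A : compl y ∈ A
  compl-y∈A = count-mem (compl y) A (ℕP.n≢0⇒n>0 λ none →
    ℕP.<⇒≱ lt (ℕP.≤-trans (ℕP.m≤m+n _ _) (ℕP.≤-reflexive (trans (balanced y) (cong (_+ count y B) none)))))
  pair : ∃ λ w → w ∈ B × compl w ∈ B
  pair with any? (λ w → 0 ℕP.<? count (compl w) B) B
  ... | yes found = let w , w∈B , positive = find found in w , w∈B , count-mem (compl w) B positive
  ... | no  none  = ⊥-elim (ℕP.<-irrefl (sym length≡) (dominance B A dominated y lt))
    where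
    dominated : ∀ ℓ → count ℓ B ≤ count ℓ A
    dominated ℓ with count ℓ B ℕ.≟ 0 | count (compl ℓ) B ℕ.≟ 0
    ... | yes zero-ℓ | _ = subst (_≤ count ℓ A) (sym zero-ℓ) z≤n
    ... | no  _      | yes zero-ℓ̄ = begin
      count ℓ B                          ≤⟨ ℕP.m≤n+m _ _ ⟩
      count (compl ℓ) A + count ℓ B      ≡⟨ sym (balanced ℓ) ⟩
      count ℓ A + count (compl ℓ) B      ≡⟨ cong (λ n → count ℓ A + n) zero-ℓ̄ ⟩
      count ℓ A + 0                      ≡⟨ ℕP.+-identityʳ _ ⟩
      count ℓ A                          ∎
      where open ℕP.≤-Reasoning
    ... | no  nonzero-ℓ | no nonzero-ℓ̄ =
      ⊥-elim (none (lose (count-mem ℓ B (ℕP.n≢0⇒n>0 nonzero-ℓ)) (ℕP.n≢0⇒n>0 nonzero-ℓ̄)))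

conflict-sym : ∀ Y Z → Conflict Y Z → Conflict Z Y
conflict-sym Y Z (p , p∈Y , p̄∈Z) = compl p , p̄∈Z , subst (_∈C Y) (sym (compl-involutive p)) p∈Y

var-compl : ∀ q → var (compl q) ≡ var q
var-compl (pos _) = refl
var-compl (neg _) = refl

compl-≢ : ∀ q → compl q ≢ q
compl-≢ (pos _) ()
compl-≢ (neg _) ()

no-self-conflict : ∀ C → ¬ Conflict C C
no-self-conflict C (q , inj₁ q≡₁ , inj₁ q̄≡₁) = compl-≢ q (trans q̄≡₁ (sym q≡₁))
no-self-conflict C (q , inj₂ q≡₂ , inj₂ q̄≡₂) = compl-≢ q (trans q̄≡₂ (sym q≡₂))
no-self-conflict C (q , inj₁ q≡₁ , inj₂ q̄≡₂) =
  distinct C (trans (cong var (sym q≡₁)) (trans (sym (var-compl q)) (cong var q̄≡₂)))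
no-self-conflict C (q , inj₂ q≡₂ , inj₁ q̄≡₁) =
  distinct C (trans (cong var (sym q̄≡₁)) (trans (var-compl q) (cong var q≡₂)))

-- Clauses  p y,  p ȳ,  p̄ w,  p̄ w̄  of F pairwise conflict, so they form a
-- semicomplete subformula (their positions are distinct since no clause
-- conflicts with itself).
semicomplete : ∀ F p y w {i₁ i₂ i₃ i₄ : Fin (length F)} →
  p ∈C lookup F i₁ × y ∈C lookup F i₁ → p ∈C lookup F i₂ × compl y ∈C lookup F i₂ →
  compl p ∈C lookup F i₃ × w ∈C lookup F i₃ → compl p ∈C lookup F i₄ × compl w ∈C lookup F i₄ →
  HasSemicompleteSub F
semicomplete F p y w {i₁} {i₂} {i₃} {i₄} (p₁ , y₁) (p₂ , ȳ₂) (p̄₃ , w₃) (p̄₄ , w̄₄) =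
  position , injective , conflicts
  where
  position : Fin 4 → Fin (length F)
  position 0F = i₁
  position 1F = i₂
  position 2F = i₃
  position 3F = i₄
  conflicts : ∀ a b → a ≢ b → Conflict (lookup F (position a)) (lookup F (position b))
  conflicts 0F 1F _ = y , y₁ , ȳ₂
  conflicts 0F 2F _ = p , p₁ , p̄₃
  conflicts 0F 3F _ = p , p₁ , p̄₄
  conflicts 1F 2F _ = p , p₂ , p̄₃
  conflicts 1F 3F _ = p , p₂ , p̄₄
  conflicts 2F 3F _ = w , w₃ , w̄₄
  conflicts 1F 0F _ = conflict-sym (lookup F i₁) (lookup F i₂) (conflicts 0F 1F (λ ()))
  conflicts 2F 0F _ = conflict-sym (lookup F i₁) (lookup F i₃) (conflicts 0F 2F (λ ()))
  conflicts 3F 0F _ = conflict-sym (lookup F i₁) (lookup F i₄) (conflicts 0F 3F (λ ()))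
  conflicts 2F 1F _ = conflict-sym (lookup F i₂) (lookup F i₃) (conflicts 1F 2F (λ ()))
  conflicts 3F 1F _ = conflict-sym (lookup F i₂) (lookup F i₄) (conflicts 1F 3F (λ ()))
  conflicts 3F 2F _ = conflict-sym (lookup F i₃) (lookup F i₄) (conflicts 2F 3F (λ ()))
  conflicts 0F 0F a≢a = ⊥-elim (a≢a refl)
  conflicts 1F 1F a≢a = ⊥-elim (a≢a refl)
  conflicts 2F 2F a≢a = ⊥-elim (a≢a refl)
  conflicts 3F 3F a≢a = ⊥-elim (a≢a refl)
  injective : ∀ {a b} → position a ≡ position b → a ≡ b
  injective {a} {b} same with a Fin.≟ b
  ... | yes a≡b = a≡b
  ... | no  a≢b = ⊥-elim (no-self-conflict (lookup F (position a))
                    (subst (λ i → Conflict (lookup F (position a)) (lookup F i)) (sym same) (conflicts a b a≢b)))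

semicomplete-from-partners : ∀ F p y w →
  y ∈ allPartners p F → compl y ∈ allPartners p F →
  w ∈ allPartners (compl p) F → compl w ∈ allPartners (compl p) F → HasSemicompleteSub F
semicomplete-from-partners F p y w y∈ ȳ∈ w∈ w̄∈ =
  semicomplete F p y w (proj₂ (allPartners-mem F y∈)) (proj₂ (allPartners-mem F ȳ∈))
                       (proj₂ (allPartners-mem F w∈)) (proj₂ (allPartners-mem F w̄∈))

silent-partners : ∀ F x → ¬ Occurs (formulaPoly F) x →
                  length (allPartners (pos x) F) ≡ length (allPartners (neg x) F) ×
                  Balanced (allPartners (pos x) F) (allPartners (neg x) F)
silent-partners F x silent = same-length , balanced
  where
  A = allPartners (pos x) F
  B = allPartners (neg x) F
  linear-zero : linCoef x (formulaPoly F) ≡ 0ℤ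
  linear-zero with linCoef x (formulaPoly F) ℤ.≟ 0ℤ
  ... | yes zero-lin = zero-lin
  ... | no  nonzero  = ⊥-elim (silent (inj₁ nonzero))
  quad-zero : ∀ v → quadCoef x v (formulaPoly F) ≡ 0ℤ
  quad-zero v with quadCoef x v (formulaPoly F) ℤ.≟ 0ℤ
  ... | yes zero-quad = zero-quad
  ... | no  nonzero   = ⊥-elim (silent (inj₂ (v , nonzero)))
  same-length : length A ≡ length B
  same-length = sym (ℤP.+-injective (subst (λ l → l +ᶻ + length B ≡ + length A) linear-zero (linear-partners x F)))
  balanced-pos : ∀ v → count (pos v) A + count (neg v) B ≡ count (neg v) A + count (pos v) B
  balanced-pos v = ℤP.+-injective (subst (λ q → q +ᶻ + (count (pos v) A + count (neg v) B)
                                                 ≡ + (count (neg v) A + count (pos v) B))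
                                          (quad-zero v) (quad-partners x v F))
  balanced : Balanced A B
  balanced (pos v) = balanced-pos v
  balanced (neg v) = sym (balanced-pos v)

unbalanced-semicomplete : ∀ F p y →
  length (allPartners p F) ≡ length (allPartners (compl p) F) →
  Balanced (allPartners p F) (allPartners (compl p) F) →
  count y (allPartners (compl p) F) < count y (allPartners p F) → HasSemicompleteSub F
unbalanced-semicomplete F p y same-length balanced more =
  let ȳ∈ , w , w∈ , w̄∈ = complementary-pair (allPartners p F) (allPartners (compl p) F) y same-length balanced more
      y∈ = count-mem y (allPartners p F) (ℕP.≤-<-trans z≤n more)
  in semicomplete-from-partners F p y w y∈ ȳ∈ w∈ w̄∈

-- Bridge: in a formula without semicomplete subformula, every significant
-- variable x occurs in the Fourier polynomial.  Otherwise the partner lists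
-- of x and x̄ are balanced, and significance makes some y more frequent in
-- one of them.
significant-occurs : ∀ F x → ¬ HasSemicompleteSub F → Significant F x → Occurs (formulaPoly F) x
significant-occurs F x noSemicomplete (y , occ≢) with occurs? (formulaPoly F) x
... | yes occurs = occurs
... | no  silent with silent-partners F x silent
                      | ℕP.<-cmp (count y (allPartners (neg x) F)) (count y (allPartners (pos x) F))
...   | _ , _ | tri≈ _ same _ =
  ⊥-elim (occ≢ (trans (occ-partners F (pos x) y) (trans (sym same) (sym (occ-partners F (neg x) y)))))
...   | same-length , balanced | tri< more-in-A _ _ =
  ⊥-elim (noSemicomplete (unbalanced-semicomplete F (pos x) y same-length balanced more-in-A))
...   | same-length , balanced | tri> _ _ more-in-B =
  ⊥-elim (noSemicomplete (unbalanced-semicomplete F (neg x) y (sym same-length)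
                            (balanced-sym {allPartners (pos x) F} {allPartners (neg x) F} balanced) more-in-B))

thirds : ∀ k j → 3 * k ∸ 1 ≤ 3 * j → k ≤ j
thirds k j bound = ℕP.≮⇒≥ λ j<k → ℕP.1+n≰n (begin
  suc (3 * j)         ≤⟨ ℕP.n≤1+n _ ⟩
  3 + 3 * j ∸ 1       ≡⟨ cong (_∸ 1) (sym (ℕP.*-suc 3 j)) ⟩
  3 * suc j ∸ 1       ≤⟨ ℕP.∸-monoˡ-≤ 1 (ℕP.*-monoʳ-≤ 3 j<k) ⟩
  3 * k ∸ 1           ≤⟨ bound ⟩
  3 * j               ∎)
  where open ℕP.≤-Reasoning

sat-bound : ∀ {m s n} k v → 3 * k ∸ 1 ≤ m → + m ≤ᶻ + 3 *ᶻ v → + n ≡ + s +ᶻ v → s + k ≤ n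
sat-bound k -[1+ j ] _ () _
sat-bound {m} {s} {n} k (+ j) enough value value≡ = begin
  s + k    ≤⟨ ℕP.+-monoʳ-≤ s (thirds k j (ℕP.≤-trans enough (ℤP.drop‿+≤+ (subst (+ m ≤ᶻ_) (sym (ℤP.pos-* 3 j)) value)))) ⟩
  s + j    ≡⟨ ℤP.+-injective (trans (ℤP.pos-+ s j) (sym value≡)) ⟩
  n        ∎
  where open ℕP.≤-Reasoning

theorem5p3 : (F : Formula) (k : ℕ) → ¬ HasSemicompleteSub F →
    AtLeastSignificant F (3 * k ∸ 1) → FourSatAtLeast F (3 * size F + k)
theorem5p3 F k noSemicomplete (xs , unique , significant , enough) =
  let P = formulaPoly F
      α , value = lowerBound (suc (weight P)) P ℕP.≤-refl (formulaPoly-multilinear F) xs unique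
                    (All.map (significant-occurs F _ noSemicomplete) significant)
  in α , sat-bound k (eval α P) enough value (numSat-eval α F)
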